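{- Every finite tree $T$ is realizable, i.e., there exists a directed multigraph $G$ whose hike dependency graph $\phi(G)$ is isomorphic to $T$.
   Context: A directed multigraph has a finite vertex set and a finite multiset of arcs (loops and multiple arcs allowed). A simple cycle is a closed sequence of arcs $(i_0,i_1)_{k_1}\cdots(i_{\ell-1},i_0)_{k_\ell}$, $\ell\ge1$, with all $i_t$ distinct, considered up to cyclic rotation (orientation and the specific arcs used matter; a self-loop is a simple cycle of length one). The hike dependency graph $\phi(G)$ is the simple graph whose vertices are the simple cycles of $G$, two distinct simple cycles being adjacent iff they share a vertex of $G$. -}

module Defs where

open import Data.Nat using (ℕ; zero; suc; _+_; _≤_)
open import Data.Nat.DivMod using (_mod_)
open import Data.Fin using (Fin; toℕ)
open import Data.Bool using (Bool; true; false)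
open import Data.Product using (Σ; ∃; ∃-syntax; _×_; _,_)
open import Relation.Binary.PropositionalEquality using (_≡_; _≢_)
open import Relation.Nullary using (¬_)
open import Function.Bundles using (_⇔_)

record SimpleGraph (n : ℕ) : Set where
  field
    adj     : Fin n → Fin n → Bool
    adj-sym : ∀ i j → adj i j ≡ adj j i
    adj-irr : ∀ i → adj i i ≡ false

open SimpleGraph public

Edge : ∀ {n} → SimpleGraph n → Fin n → Fin n → Set
Edge T i j = adj T i j ≡ true

cyc : (k : ℕ) → ℕ → Fin (suc k)
cyc k t = t mod (suc k)

record Walk {n} (T : SimpleGraph n) (i j : Fin n) : Set where
  field
    len   : ℕ
    vtx   : ℕ → Fin n
    start : vtx 0 ≡ i
    end   : vtx len ≡ j
    step  : ∀ t → suc t ≤ len → Edge T (vtx t) (vtx (suc t))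

Connected : ∀ {n} → SimpleGraph n → Set
Connected T = ∀ i j → Walk T i j

record GraphCycle {n} (T : SimpleGraph n) : Set where
  field
    m        : ℕ
    vtx      : Fin (suc (suc (suc m))) → Fin n
    distinct : ∀ s t → vtx s ≡ vtx t → s ≡ t
    closed   : ∀ t → Edge T (vtx t) (vtx (cyc (suc (suc m)) (suc (toℕ t))))

Acyclic : ∀ {n} → SimpleGraph n → Set
Acyclic T = ¬ GraphCycle T

IsTree : ∀ {n} → SimpleGraph n → Set
IsTree {n} T = (1 ≤ n) × Connected T × Acyclic T

record Multigraph : Set where
  field
    V   : ℕ
    E   : ℕ
    src : Fin E → Fin V
    tgt : Fin E → Fin V

open Multigraph public

-- A simple cycle (i_0,i_1)_{k_1} ⋯ (i_{ℓ-1},i_0)_{k_ℓ} of length ℓ = suc len-1,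
-- given as an arc sequence; i_t = src (arc t) are pairwise distinct.
record SimpleCycle (G : Multigraph) : Set where
  field
    len-1    : ℕ
    arc      : Fin (suc len-1) → Fin (E G)
    closed   : ∀ t → tgt G (arc t) ≡ src G (arc (cyc len-1 (suc (toℕ t))))
    distinct : ∀ s t → src G (arc s) ≡ src G (arc t) → s ≡ t

open SimpleCycle public

arcAt : ∀ {G} → SimpleCycle G → ℕ → Fin (E G)
arcAt c t = arc c (cyc (len-1 c) t)

-- two arc sequences represent the same simple cycle iff they agree up to cyclic rotation
SameCycle : ∀ {G} → SimpleCycle G → SimpleCycle G → Set
SameCycle c d = (len-1 c ≡ len-1 d) × ∃[ r ] (∀ t → arcAt d t ≡ arcAt c (t + r))

ShareVertex : ∀ {G} → SimpleCycle G → SimpleCycle G → Set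
ShareVertex {G} c d = ∃[ s ] ∃[ t ] (src G (arc c s) ≡ src G (arc d t))

φAdj : ∀ {G} → SimpleCycle G → SimpleCycle G → Set
φAdj c d = ¬ SameCycle c d × ShareVertex c d

record IsoToφ {n} (T : SimpleGraph n) (G : Multigraph) : Set where
  field
    f         : Fin n → SimpleCycle G
    injective : ∀ i j → SameCycle (f i) (f j) → i ≡ j
    surjective : ∀ (c : SimpleCycle G) → ∃[ i ] SameCycle (f i) c
    adjacency : ∀ i j → Edge T i j ⇔ φAdj (f i) (f j)

Realizable : ∀ {n} → SimpleGraph n → Set
Realizable T = ∃[ G ] IsoToφ T G

{-# OPTIONS --safe #-}
module Submission where

-- Replace every vertex x of T by a directed cycle through one new vertex {x , y} for each
-- neighbour y of x (a loop if x is a leaf); the cycles of x and y meet exactly when xy is an edge.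
-- A simple cycle that stays on the cycle of one x is that cycle. Otherwise the sequence of cycles
-- it visits is a closed walk in T whose moves use pairwise distinct edges {x , y}, because the
-- simple cycle passes through the vertex {x , y} only once; an acyclic graph has no such walk.
-- The one-vertex tree is realized by a single loop.

open import Defs
open import Data.Nat using (ℕ; zero; suc; pred; _+_; _*_; _∸_; _≤_; _<_; z≤n; s≤s; NonZero; _<?_; _≤?_; anyUpTo?)
open import Data.Nat.Properties
open import Data.Nat.DivMod
open import Data.Nat.Induction using (<-rec)
open import Data.Bool as Bool using (true)
open import Data.Fin as Fin using (Fin; toℕ; combine; remQuot; inject≤)
import Data.Fin.Properties as Finₚ
open import Data.List using (List; _∷_; filter; allFin; length; lookup)
open import Data.List.Properties using (length-filter; length-tabulate)
open import Data.List.Membership.Propositional using (_∈_)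
open import Data.List.Membership.Propositional.Properties using (∈-filter⁺; ∈-filter⁻; ∈-allFin; ∈-lookup)
open import Data.List.Relation.Unary.Any using (index)
open import Data.List.Relation.Unary.Any.Properties using (lookup-index)
import Data.List.Relation.Unary.All as All
open import Data.List.Relation.Unary.AllPairs using (_∷_)
open import Data.List.Relation.Unary.Unique.Propositional using (Unique)
import Data.List.Relation.Unary.Unique.Propositional.Properties as Uniqueₚ
open import Data.Product using (∃-syntax; _×_; _,_; proj₁; proj₂; swap; uncurry)
open import Data.Sum using (_⊎_; inj₁; inj₂)
open import Data.Empty using (⊥)
open import Function using (_∘′_)
open import Function.Bundles using (_⇔_; mk⇔)
open import Relation.Nullary using (¬_; Dec; yes; no; contradiction)
open import Relation.Nullary.Decidable using (_×-dec_; ¬?; decidable-stable)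
open import Relation.Unary using (Decidable)
open import Relation.Binary.PropositionalEquality
open import Relation.Binary.Definitions using (tri<; tri≈; tri>)

[m+n%d]%d≡[m+n]%d : ∀ m n d .{{_ : NonZero d}} → (m + n % d) % d ≡ (m + n) % d
[m+n%d]%d≡[m+n]%d m n d = begin
  (m + n % d) % d           ≡⟨ %-distribˡ-+ m (n % d) d ⟩
  (m % d + n % d % d) % d   ≡⟨ cong (λ z → (m % d + z) % d) (m%n%n≡m%n n d) ⟩
  (m % d + n % d) % d       ≡⟨ %-distribˡ-+ m n d ⟨
  (m + n) % d               ∎
  where open ≡-Reasoning

[m+n]%d≢m : ∀ m n d .{{_ : NonZero d}} → m < d → 0 < n → n < d → (m + n) % d ≢ m
[m+n]%d≢m m n d m<d 0<n n<d eq with m + n <? d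
... | yes m+n<d = m+n≢m (trans (sym (m<n⇒m%n≡m m+n<d)) eq)
  where
  m+n≢m : m + n ≢ m
  m+n≢m e = <-irrefl (sym e) (subst (_< m + n) (+-identityʳ m) (+-monoʳ-< m 0<n))
... | no m+n≮d = <-irrefl n≡d n<d
  where
  d≤m+n : d ≤ m + n
  d≤m+n = ≮⇒≥ m+n≮d
  m+n∸d<d : m + n ∸ d < d
  m+n∸d<d = +-cancelʳ-< _ _ d (subst (_< d + d) (sym (m∸n+n≡m d≤m+n)) (+-mono-< m<d n<d))
  m+n∸d≡m : m + n ∸ d ≡ m
  m+n∸d≡m = trans (sym (m<n⇒m%n≡m m+n∸d<d)) (trans (m≤n⇒[n∸m]%m≡n%m d≤m+n) eq)
  n≡d : n ≡ d
  n≡d = +-cancelˡ-≡ m n d (trans (sym (m∸n+n≡m d≤m+n)) (cong (_+ d) m+n∸d≡m))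

toℕ-cyc : ∀ k t → toℕ (cyc k t) ≡ t % suc k
toℕ-cyc k t = Finₚ.toℕ-fromℕ< (m%n<n t (suc k))

cyc-toℕ : ∀ {k} (t : Fin (suc k)) → cyc k (toℕ t) ≡ t
cyc-toℕ {k} t = Finₚ.toℕ-injective (trans (toℕ-cyc k (toℕ t)) (m<n⇒m%n≡m (Finₚ.toℕ<n t)))

cyc-toℕ-cyc : ∀ k t → cyc k (toℕ (cyc k t)) ≡ cyc k t
cyc-toℕ-cyc k t = cyc-toℕ (cyc k t)

cyc-suc-toℕ-cyc : ∀ k t → cyc k (suc (toℕ (cyc k t))) ≡ cyc k (suc t)
cyc-suc-toℕ-cyc k t = Finₚ.toℕ-injective (begin
  toℕ (cyc k (suc (toℕ (cyc k t))))  ≡⟨ toℕ-cyc k (suc (toℕ (cyc k t))) ⟩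
  suc (toℕ (cyc k t)) % suc k         ≡⟨ cong (λ z → suc z % suc k) (toℕ-cyc k t) ⟩
  (1 + t % suc k) % suc k             ≡⟨ [m+n%d]%d≡[m+n]%d 1 t (suc k) ⟩
  suc t % suc k                       ≡⟨ toℕ-cyc k (suc t) ⟨
  toℕ (cyc k (suc t))                 ∎)
  where open ≡-Reasoning

cyc-suc-injective : ∀ {k s t} → s < suc k → t < suc k → cyc k (suc s) ≡ cyc k (suc t) → s ≡ t
cyc-suc-injective {k} {s} {t} s≤k t≤k e = begin
  s                              ≡⟨ recover s≤k ⟨
  (toℕ (cyc k (suc s)) + k) % n  ≡⟨ cong (λ r → (toℕ r + k) % n) e ⟩
  (toℕ (cyc k (suc t)) + k) % n  ≡⟨ recover t≤k ⟩
  t                              ∎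
  where
  open ≡-Reasoning
  n = suc k
  recover : ∀ {m} → m < n → (toℕ (cyc k (suc m)) + k) % n ≡ m
  recover {m} m<n = begin
    (toℕ (cyc k (suc m)) + k) % n  ≡⟨ cong (λ r → (r + k) % n) (toℕ-cyc k (suc m)) ⟩
    (suc m % n + k) % n            ≡⟨ cong (_% n) (+-comm (suc m % n) k) ⟩
    (k + suc m % n) % n            ≡⟨ [m+n%d]%d≡[m+n]%d k (suc m) n ⟩
    (k + suc m) % n                ≡⟨ cong (_% n) (trans (+-suc k m) (+-comm n m)) ⟩
    (m + n) % n                    ≡⟨ [m+n]%n≡m%n m n ⟩
    m % n                          ≡⟨ m<n⇒m%n≡m m<n ⟩
    m                              ∎

Least : (ℕ → Set) → Set
Least P = ∃[ g ] P g × (∀ {h} → h < g → ¬ P h)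

least : ∀ {P : ℕ → Set} → Decidable P → ∀ {k} → P k → Least P
least {P} P? {k} = <-rec (λ k → P k → Least P) step k
  where
  step : ∀ k → (∀ {j} → j < k → P j → Least P) → P k → Least P
  step k rec pk with anyUpTo? P? k
  ... | yes (j , j<k , pj) = rec j<k pj
  ... | no none = k , pk , λ h<k ph → none (_ , h<k , ph)

Edge⇒≢ : ∀ {n} (T : SimpleGraph n) {x y} → Edge T x y → x ≢ y
Edge⇒≢ T {x} e refl with trans (sym e) (adj-irr T x)
... | ()

Edge-sym : ∀ {n} (T : SimpleGraph n) {x y} → Edge T x y → Edge T y x
Edge-sym T {x} {y} e = trans (adj-sym T y x) e

SamePair : ∀ {A : Set} → A → A → A → A → Set
SamePair a b c d = (a ≡ c × b ≡ d) ⊎ (a ≡ d × b ≡ c)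

-- Stationary steps w t ≡ w (suc t) are allowed; only the moving steps must use distinct edges.
record ClosedTrail {n} (T : SimpleGraph n) (k : ℕ) (w : ℕ → Fin n) : Set where
  field
    closes         : w k ≡ w 0
    step           : ∀ {t} → t < k → w t ≡ w (suc t) ⊎ Edge T (w t) (w (suc t))
    moves          : ∃[ t ] t < k × w t ≢ w (suc t)
    edges-distinct : ∀ {s t} → s < k → t < k → w s ≢ w (suc s) → w t ≢ w (suc t) →
                     SamePair (w s) (w (suc s)) (w t) (w (suc t)) → s ≡ t

module StrictClosedTrail {n} {T : SimpleGraph n} (acyclic : Acyclic T) {k} {w : ℕ → Fin n}
         (1≤k : 1 ≤ k) (closes : w k ≡ w 0)
         (edge : ∀ {t} → t < k → Edge T (w t) (w (suc t)))
         (edges-distinct : ∀ {s t} → s < k → t < k → SamePair (w s) (w (suc s)) (w t) (w (suc t)) → s ≡ t)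
         where

  Repeat : ℕ → Set
  Repeat g = 1 ≤ g × ∃[ i ] i < suc k × g + i ≤ k × w i ≡ w (g + i)

  repeat? : ∀ g → Dec (Repeat g)
  repeat? g = (1 ≤? g) ×-dec anyUpTo? (λ i → (g + i ≤? k) ×-dec (w i Fin.≟ w (g + i))) (suc k)

  whole-repeat : Repeat k
  whole-repeat = 1≤k , 0 , s≤s z≤n , ≤-reflexive (+-identityʳ k) , trans (sym closes) (cong w (sym (+-identityʳ k)))

  -- A shortest repeat w i ≡ w (g + i) is a loop (g = 1), an edge used twice (g = 2), or a graph cycle.
  no-shortest-repeat : ∀ {g} i → 1 ≤ g → g + i ≤ k → w i ≡ w (g + i) → (∀ {h} → h < g → ¬ Repeat h) → ⊥
  no-shortest-repeat {1} i _ g+i≤k eq _ = Edge⇒≢ T (edge g+i≤k) eq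
  no-shortest-repeat {2} i _ g+i≤k eq _ =
    1+n≢n (sym (edges-distinct (<-trans (n<1+n i) g+i≤k) g+i≤k (inj₂ (eq , refl))))
  no-shortest-repeat {g@(suc (suc (suc c)))} i _ g+i≤k eq shortest = acyclic record
    { m = c ; vtx = vtx ; distinct = vtx-distinct ; closed = vtx-closed }
    where
    vtx : Fin g → Fin n
    vtx t = w (toℕ t + i)

    no-inner-repeat : ∀ {a b} → a < b → b < g → w (a + i) ≢ w (b + i)
    no-inner-repeat {a} {b} a<b b<g e = shortest (≤-<-trans (m∸n≤m b a) b<g)
      (m<n⇒0<n∸m a<b , a + i , s≤s (≤-trans (m≤n+m (a + i) (b ∸ a)) b∸a+[a+i]≤k) , b∸a+[a+i]≤k ,
       trans e (cong w (sym b∸a+[a+i]≡b+i)))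
      where
      b∸a+[a+i]≡b+i : b ∸ a + (a + i) ≡ b + i
      b∸a+[a+i]≡b+i = trans (sym (+-assoc (b ∸ a) a i)) (cong (_+ i) (m∸n+n≡m (<⇒≤ a<b)))
      b∸a+[a+i]≤k : b ∸ a + (a + i) ≤ k
      b∸a+[a+i]≤k = subst (_≤ k) (sym b∸a+[a+i]≡b+i) (≤-trans (<⇒≤ (+-monoˡ-< i b<g)) g+i≤k)

    vtx-distinct : ∀ s t → vtx s ≡ vtx t → s ≡ t
    vtx-distinct s t e with <-cmp (toℕ s) (toℕ t)
    ... | tri< s<t _ _ = contradiction e (no-inner-repeat s<t (Finₚ.toℕ<n t))
    ... | tri≈ _ s≡t _ = Finₚ.toℕ-injective s≡t
    ... | tri> _ _ t<s = contradiction (sym e) (no-inner-repeat t<s (Finₚ.toℕ<n s))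

    wrap : ∀ j → j ≤ g → w (j % g + i) ≡ w (j + i)
    wrap j j≤g with m<1+n⇒m<n∨m≡n (s≤s j≤g)
    ... | inj₁ j<g = cong (λ z → w (z + i)) (m<n⇒m%n≡m j<g)
    ... | inj₂ refl = trans (cong (λ z → w (z + i)) (n%n≡0 g)) eq

    vtx-closed : ∀ t → Edge T (vtx t) (vtx (cyc (suc (suc c)) (suc (toℕ t))))
    vtx-closed t = subst (Edge T (vtx t))
      (sym (trans (cong (λ z → w (z + i)) (toℕ-cyc (suc (suc c)) (suc (toℕ t)))) (wrap (suc (toℕ t)) (Finₚ.toℕ<n t))))
      (edge (<-≤-trans (+-monoˡ-< i (Finₚ.toℕ<n t)) g+i≤k))

  impossible : ⊥
  impossible with least repeat? whole-repeat
  ... | g , (1≤g , i , _ , g+i≤k , eq) , shortest = no-shortest-repeat i 1≤g g+i≤k eq shortest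

skip : ℕ → ℕ → ℕ
skip s t with t <? s
... | yes _ = t
... | no _ = suc t

skip-< : ∀ {s t} → t < s → skip s t ≡ t
skip-< {s} {t} t<s with t <? s
... | yes _ = refl
... | no t≮s = contradiction t<s t≮s

skip-≮ : ∀ {s t} → ¬ t < s → skip s t ≡ suc t
skip-≮ {s} {t} t≮s with t <? s
... | yes t<s = contradiction t<s t≮s
... | no _ = refl

skip≤suc : ∀ s t → skip s t ≤ suc t
skip≤suc s t with t <? s
... | yes _ = n≤1+n t
... | no _ = ≤-refl

m<o∧n≮o⇒m≢1+n : ∀ {m n o} → m < o → ¬ n < o → m ≢ suc n
m<o∧n≮o⇒m≢1+n m<o n≮o refl = 1+n≰n (≤-trans (n≤1+n _) (≤-trans m<o (≮⇒≥ n≮o)))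

skip-injective : ∀ s {a b} → skip s a ≡ skip s b → a ≡ b
skip-injective s {a} {b} e with a <? s | b <? s
... | yes _ | yes _ = e
... | no _ | no _ = suc-injective e
... | yes a<s | no b≮s = contradiction e (m<o∧n≮o⇒m≢1+n a<s b≮s)
... | no a≮s | yes b<s = contradiction (sym e) (m<o∧n≮o⇒m≢1+n b<s a≮s)

skip-surjective : ∀ {k s u} → s < suc k → u < suc k → u ≢ s → ∃[ u' ] u' < k × skip s u' ≡ u
skip-surjective {k} {s} {u} s≤k u≤k u≢s with <-cmp u s
... | tri< u<s _ _ = u , <-≤-trans u<s (≤-pred s≤k) , skip-< u<s
... | tri≈ _ u≡s _ = contradiction u≡s u≢s
... | tri> _ _ s<u with u | s<u
...   | suc u' | s<1+u' = u' , ≤-pred u≤k , skip-≮ (≤⇒≯ (≤-pred s<1+u'))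

module DeleteStationaryStep {n} {T : SimpleGraph n} {k} {w : ℕ → Fin n} (trail : ClosedTrail T (suc k) w)
         {s} (s≤k : s < suc k) (stationary : w s ≡ w (suc s)) where
  open ClosedTrail trail

  w′ : ℕ → Fin n
  w′ t = w (skip s t)

  w′-suc : ∀ t → w′ (suc t) ≡ w (suc (skip s t))
  w′-suc t with t <? s
  ... | no t≮s = cong w (skip-≮ (λ 1+t<s → t≮s (<-trans (n<1+n t) 1+t<s)))
  ... | yes t<s with m<1+n⇒m<n∨m≡n (s≤s t<s)
  ...   | inj₁ 1+t<s = cong w (skip-< 1+t<s)
  ...   | inj₂ 1+t≡s = begin
    w (skip s (suc t))  ≡⟨ cong w (skip-≮ (<-irrefl 1+t≡s)) ⟩
    w (suc (suc t))     ≡⟨ cong (λ z → w (suc z)) 1+t≡s ⟩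
    w (suc s)           ≡⟨ stationary ⟨
    w s                 ≡⟨ cong w 1+t≡s ⟨
    w (suc t)           ∎
    where open ≡-Reasoning

  skip<1+k : ∀ {t} → t < k → skip s t < suc k
  skip<1+k {t} t<k = ≤-<-trans (skip≤suc s t) (s≤s t<k)

  w′-start : w′ 0 ≡ w 0
  w′-start with <-cmp 0 s
  ... | tri< 0<s _ _ = cong w (skip-< 0<s)
  ... | tri≈ _ 0≡s _ = trans (cong w (skip-≮ (<-irrefl 0≡s)))
                         (sym (subst (λ z → w z ≡ w (suc z)) (sym 0≡s) stationary))

  shortened : ClosedTrail T k w′
  shortened = record
    { closes = trans (cong w (skip-≮ (≤⇒≯ (≤-pred s≤k)))) (trans closes (sym w′-start))
    ; step = λ {t} t<k → subst (λ z → w′ t ≡ z ⊎ Edge T (w′ t) z) (sym (w′-suc t)) (step (skip<1+k t<k))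
    ; moves = moves′
    ; edges-distinct = λ {a} {b} a<k b<k a-moves b-moves same → skip-injective s
        (edges-distinct (skip<1+k a<k) (skip<1+k b<k)
          (λ e → a-moves (trans e (sym (w′-suc a)))) (λ e → b-moves (trans e (sym (w′-suc b))))
          (subst₂ (λ y z → SamePair (w′ a) y (w′ b) z) (w′-suc a) (w′-suc b) same))
    }
    where
    moves′ : ∃[ t ] t < k × w′ t ≢ w′ (suc t)
    moves′ with moves
    ... | u , u≤k , u-moves with skip-surjective s≤k u≤k (λ { refl → u-moves stationary })
    ...   | u' , u'<k , refl = u' , u'<k , λ e → u-moves (trans e (w′-suc u'))

acyclic⇒¬ClosedTrail : ∀ {n} {T : SimpleGraph n} → Acyclic T → ∀ k w → ¬ ClosedTrail T k w
acyclic⇒¬ClosedTrail acyclic zero w trail with ClosedTrail.moves trail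
... | _ , () , _
acyclic⇒¬ClosedTrail {T = T} acyclic (suc k) w trail
  with anyUpTo? (λ s → w s Fin.≟ w (suc s)) (suc k)
... | yes (s , s≤k , stationary) =
  acyclic⇒¬ClosedTrail acyclic k _ (DeleteStationaryStep.shortened trail s≤k stationary)
... | no none = StrictClosedTrail.impossible acyclic (s≤s z≤n) closes edge
  (λ s<k t<k → edges-distinct s<k t<k (moving s<k) (moving t<k))
  where
  open ClosedTrail trail
  moving : ∀ {t} → t < suc k → w t ≢ w (suc t)
  moving t<k e = none (_ , t<k , e)
  edge : ∀ {t} → t < suc k → Edge T (w t) (w (suc t))
  edge t<k with step t<k
  ... | inj₁ e = contradiction e (moving t<k)
  ... | inj₂ e = e

lookup-injective : ∀ {A : Set} {xs : List A} → Unique xs → ∀ i j → lookup xs i ≡ lookup xs j → i ≡ j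
lookup-injective (_ ∷ _) Fin.zero Fin.zero _ = refl
lookup-injective (x∉xs ∷ _) Fin.zero (Fin.suc j) e = contradiction e (All.lookup x∉xs (∈-lookup j))
lookup-injective (x∉xs ∷ _) (Fin.suc i) Fin.zero e = contradiction (sym e) (All.lookup x∉xs (∈-lookup i))
lookup-injective (_ ∷ unique) (Fin.suc i) (Fin.suc j) e = cong Fin.suc (lookup-injective unique i j e)

cast-injective : ∀ {m n} .(eq : m ≡ n) {i j : Fin m} → Fin.cast eq i ≡ Fin.cast eq j → i ≡ j
cast-injective eq {i} {j} e =
  Finₚ.toℕ-injective (trans (sym (Finₚ.toℕ-cast eq i)) (trans (cong toℕ e) (Finₚ.toℕ-cast eq j)))

-- Neighbours of x are enumerated cyclically: nbr x j only depends on j modulo the degree.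
module Neighbours {n} (T : SimpleGraph n) (hasNbr : ∀ x → ∃[ y ] Edge T x y) where

  nbrs : Fin n → List (Fin n)
  nbrs x = filter (λ y → adj T x y Bool.≟ true) (allFin n)

  deg-1 : Fin n → ℕ
  deg-1 x = pred (length (nbrs x))

  ∈-nbrs : ∀ {x y} → Edge T x y → y ∈ nbrs x
  ∈-nbrs {x} {y} e = ∈-filter⁺ (λ y → adj T x y Bool.≟ true) (∈-allFin y) e

  1+deg-1≡length : ∀ x → suc (deg-1 x) ≡ length (nbrs x)
  1+deg-1≡length x with nbrs x | ∈-nbrs (proj₂ (hasNbr x))
  ... | _ ∷ _ | _ = refl

  deg-1<n : ∀ x → deg-1 x < n
  deg-1<n x = begin
    suc (deg-1 x)     ≡⟨ 1+deg-1≡length x ⟩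
    length (nbrs x)   ≤⟨ length-filter _ (allFin n) ⟩
    length (allFin n) ≡⟨ length-tabulate (λ i → i) ⟩
    n                 ∎
    where open ≤-Reasoning

  nbr : Fin n → ℕ → Fin n
  nbr x j = lookup (nbrs x) (Fin.cast (1+deg-1≡length x) (cyc (deg-1 x) j))

  nbr-edge : ∀ x j → Edge T x (nbr x j)
  nbr-edge x j = proj₂ (∈-filter⁻ (λ y → adj T x y Bool.≟ true) {xs = allFin n} (∈-lookup {xs = nbrs x} _))

  nbr-cyc : ∀ x j → nbr x (toℕ (cyc (deg-1 x) j)) ≡ nbr x j
  nbr-cyc x j = cong (λ t → lookup (nbrs x) (Fin.cast (1+deg-1≡length x) t)) (cyc-toℕ-cyc (deg-1 x) j)

  nbr-injective : ∀ x {i j} → nbr x i ≡ nbr x j → cyc (deg-1 x) i ≡ cyc (deg-1 x) j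
  nbr-injective x e = cast-injective (1+deg-1≡length x)
    (lookup-injective (Uniqueₚ.filter⁺ _ (Uniqueₚ.allFin⁺ n)) _ _ e)

  nbr-surjective : ∀ x {y} → Edge T x y → ∃[ t ] nbr x (toℕ {suc (deg-1 x)} t) ≡ y
  nbr-surjective x {y} e = t , (begin
    lookup (nbrs x) (Fin.cast eq (cyc (deg-1 x) (toℕ t)))  ≡⟨ cong (lookup (nbrs x) ∘′ Fin.cast eq) (cyc-toℕ t) ⟩
    lookup (nbrs x) (Fin.cast eq t)                        ≡⟨ cong (lookup (nbrs x)) (Finₚ.cast-trans (sym eq) eq i) ⟩
    lookup (nbrs x) (Fin.cast refl i)                      ≡⟨ cong (lookup (nbrs x)) (Finₚ.cast-is-id refl i) ⟩
    lookup (nbrs x) i                                      ≡⟨ lookup-index (∈-nbrs e) ⟨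
    y                                                      ∎)
    where
    open ≡-Reasoning
    eq = 1+deg-1≡length x
    i = index (∈-nbrs e)
    t = Fin.cast (sym eq) i

pair : ∀ {n} → Fin n → Fin n → Fin (n * n)
pair a b with toℕ a ≤? toℕ b
... | yes _ = combine a b
... | no _ = combine b a

pair-comm : ∀ {n} (a b : Fin n) → pair a b ≡ pair b a
pair-comm a b with toℕ a ≤? toℕ b | toℕ b ≤? toℕ a
... | yes a≤b | yes b≤a rewrite Finₚ.toℕ-injective (≤-antisym a≤b b≤a) = refl
... | yes _ | no _ = refl
... | no _ | yes _ = refl
... | no a≰b | no b≰a = contradiction (≰⇒≥ b≰a) a≰b

pair-injective : ∀ {n} {a b c d : Fin n} → pair a b ≡ pair c d → SamePair a b c d
pair-injective {a = a} {b} {c} {d} e with toℕ a ≤? toℕ b | toℕ c ≤? toℕ d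
... | yes _ | yes _ = inj₁ (Finₚ.combine-injective a b c d e)
... | yes _ | no _ = inj₂ (Finₚ.combine-injective a b d c e)
... | no _ | yes _ = inj₂ (swap (Finₚ.combine-injective b a c d e))
... | no _ | no _ = inj₁ (swap (Finₚ.combine-injective b a d c e))

pair-injectiveʳ : ∀ {n} (x : Fin n) {a b} → pair x a ≡ pair x b → a ≡ b
pair-injectiveʳ x {a} {b} e with pair-injective {a = x} {a} {x} {b} e
... | inj₁ (_ , a≡b) = a≡b
... | inj₂ (x≡b , a≡x) = trans a≡x x≡b

SamePair⇒pair≡ : ∀ {n} {a b c d : Fin n} → SamePair a b c d → pair a b ≡ pair c d
SamePair⇒pair≡ (inj₁ (refl , refl)) = refl
SamePair⇒pair≡ {a = a} {b} (inj₂ (refl , refl)) = pair-comm a b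

SameCycle-refl : ∀ {G} (c : SimpleCycle G) → SameCycle c c
SameCycle-refl c = refl , 0 , λ t → cong (arcAt c) (sym (+-identityʳ t))

-- Vertices are 0, 1 and one vertex {a , b} per unordered pair; arcs are the pairs (x , k) of a
-- vertex x of T and a slot k < n. The slots k ≤ deg-1 x form the cycle of x through the vertices
-- {x , y}, y a neighbour of x; the other slots are junk arcs 0 → 1, on no cycle as no arc leaves 1.
module CycleGraph {m} (T : SimpleGraph (suc m)) (hasNbr : ∀ x → ∃[ y ] Edge T x y) where
  open Neighbours T hasNbr

  N : ℕ
  N = suc m

  edgeVertex : Fin N → Fin N → Fin (2 + N * N)
  edgeVertex a b = Fin.suc (Fin.suc (pair a b))

  edgeVertex-injective : ∀ a b c d → edgeVertex a b ≡ edgeVertex c d → SamePair a b c d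
  edgeVertex-injective _ _ _ _ e = pair-injective (Finₚ.suc-injective (Finₚ.suc-injective e))

  edgeVertex-injectiveʳ : ∀ x {a b} → edgeVertex x a ≡ edgeVertex x b → a ≡ b
  edgeVertex-injectiveʳ x e = pair-injectiveʳ x (Finₚ.suc-injective (Finₚ.suc-injective e))

  slotEnds : Fin N → Fin N → Fin (2 + N * N) × Fin (2 + N * N)
  slotEnds x k with toℕ k ≤? deg-1 x
  ... | yes _ = edgeVertex x (nbr x (toℕ k)) , edgeVertex x (nbr x (suc (toℕ k)))
  ... | no _ = Fin.zero , Fin.suc Fin.zero

  G : Multigraph
  G = record
    { V = 2 + N * N
    ; E = N * N
    ; src = λ a → proj₁ (uncurry slotEnds (remQuot {N} N a))
    ; tgt = λ a → proj₂ (uncurry slotEnds (remQuot {N} N a))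
    }

  slotEnds-cycle : ∀ x k → toℕ k ≤ deg-1 x →
                   slotEnds x k ≡ (edgeVertex x (nbr x (toℕ k)) , edgeVertex x (nbr x (suc (toℕ k))))
  slotEnds-cycle x k k≤ with toℕ k ≤? deg-1 x
  ... | yes _ = refl
  ... | no k≰ = contradiction k≤ k≰

  slotEnds-junk : ∀ x k → ¬ toℕ k ≤ deg-1 x → proj₂ (slotEnds x k) ≡ Fin.suc Fin.zero
  slotEnds-junk x k k≰ with toℕ k ≤? deg-1 x
  ... | yes k≤ = contradiction k≤ k≰
  ... | no _ = refl

  slotEnds-src≢1 : ∀ x k → proj₁ (slotEnds x k) ≢ Fin.suc Fin.zero
  slotEnds-src≢1 x k with toℕ k ≤? deg-1 x
  ... | yes _ = λ ()
  ... | no _ = λ ()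

  vertexArc : (x : Fin N) → Fin (suc (deg-1 x)) → Fin (N * N)
  vertexArc x t = combine x (inject≤ t (deg-1<n x))

  vertexArc-ends : ∀ x t → (src G (vertexArc x t) , tgt G (vertexArc x t)) ≡
                           (edgeVertex x (nbr x (toℕ t)) , edgeVertex x (nbr x (suc (toℕ t))))
  vertexArc-ends x t = begin
    uncurry slotEnds (remQuot {N} N (combine x k))  ≡⟨ cong (uncurry slotEnds) (Finₚ.remQuot-combine x k) ⟩
    slotEnds x k                                    ≡⟨ slotEnds-cycle x k k≤deg-1 ⟩
    (edgeVertex x (nbr x (toℕ k)) , edgeVertex x (nbr x (suc (toℕ k))))
      ≡⟨ cong (λ j → edgeVertex x (nbr x j) , edgeVertex x (nbr x (suc j))) toℕk≡t ⟩
    (edgeVertex x (nbr x (toℕ t)) , edgeVertex x (nbr x (suc (toℕ t)))) ∎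
    where
    open ≡-Reasoning
    k = inject≤ t (deg-1<n x)
    toℕk≡t = Finₚ.toℕ-inject≤ t (deg-1<n x)
    k≤deg-1 = subst (_≤ deg-1 x) (sym toℕk≡t) (≤-pred (Finₚ.toℕ<n t))

  vertexArc-src : ∀ x t → src G (vertexArc x t) ≡ edgeVertex x (nbr x (toℕ t))
  vertexArc-src x t = cong proj₁ (vertexArc-ends x t)

  vertexArc-tgt : ∀ x t → tgt G (vertexArc x t) ≡ edgeVertex x (nbr x (suc (toℕ t)))
  vertexArc-tgt x t = cong proj₂ (vertexArc-ends x t)

  vertexCycle : Fin N → SimpleCycle G
  vertexCycle x = record
    { len-1 = deg-1 x
    ; arc = vertexArc x
    ; closed = λ t → begin
        tgt G (vertexArc x t)                                 ≡⟨ vertexArc-tgt x t ⟩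
        edgeVertex x (nbr x (suc (toℕ t)))                    ≡⟨ cong (edgeVertex x) (nbr-cyc x (suc (toℕ t))) ⟨
        edgeVertex x (nbr x (toℕ (cyc (deg-1 x) (suc (toℕ t))))) ≡⟨ vertexArc-src x _ ⟨
        src G (vertexArc x (cyc (deg-1 x) (suc (toℕ t))))     ∎
    ; distinct = λ s t e → begin
        s                         ≡⟨ cyc-toℕ s ⟨
        cyc (deg-1 x) (toℕ s)     ≡⟨ nbr-injective x {toℕ s} {toℕ t} (edgeVertex-injectiveʳ x
                                       (trans (sym (vertexArc-src x s)) (trans e (vertexArc-src x t)))) ⟩
        cyc (deg-1 x) (toℕ t)     ≡⟨ cyc-toℕ t ⟩
        t                         ∎
    }
    where open ≡-Reasoning

  vertexCycle-injective : ∀ i j → SameCycle (vertexCycle i) (vertexCycle j) → i ≡ j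
  vertexCycle-injective i j (_ , _ , rotation) = sym (Finₚ.combine-injectiveˡ j _ i _ (rotation 0))

  vertexCycle-adjacency : ∀ i j → Edge T i j ⇔ φAdj (vertexCycle i) (vertexCycle j)
  vertexCycle-adjacency i j = mk⇔ to from
    where
    to : Edge T i j → φAdj (vertexCycle i) (vertexCycle j)
    to e with nbr-surjective i e | nbr-surjective j (Edge-sym T e)
    ... | s , nbr-s≡j | t , nbr-t≡i =
      (λ same → Edge⇒≢ T e (vertexCycle-injective i j same)) , s , t , (begin
        src G (vertexArc i s)         ≡⟨ vertexArc-src i s ⟩
        edgeVertex i (nbr i (toℕ s))  ≡⟨ cong (edgeVertex i) nbr-s≡j ⟩
        edgeVertex i j                ≡⟨ cong Fin.suc (cong Fin.suc (pair-comm i j)) ⟩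
        edgeVertex j i                ≡⟨ cong (edgeVertex j) nbr-t≡i ⟨
        edgeVertex j (nbr j (toℕ t))  ≡⟨ vertexArc-src j t ⟨
        src G (vertexArc j t)         ∎)
      where open ≡-Reasoning
    from : φAdj (vertexCycle i) (vertexCycle j) → Edge T i j
    from (different , s , t , e) with edgeVertex-injective i (nbr i (toℕ s)) j (nbr j (toℕ t))
                                        (trans (sym (vertexArc-src i s)) (trans e (vertexArc-src j t)))
    ... | inj₁ (refl , _) = contradiction (SameCycle-refl (vertexCycle i)) different
    ... | inj₂ (_ , nbr-s≡j) = subst (Edge T i) nbr-s≡j (nbr-edge i (toℕ s))

  module Owners (c : SimpleCycle G) where
    L : ℕ
    L = suc (len-1 c)

    a : ℕ → Fin (N * N)
    a = arcAt c

    owner slot : ℕ → Fin N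
    owner t = proj₁ (remQuot {N} N (a t))
    slot t = proj₂ (remQuot {N} N (a t))

    pos : ℕ → ℕ
    pos t = toℕ (slot t)

    a≡combine : ∀ t → a t ≡ combine (owner t) (slot t)
    a≡combine t = sym (Finₚ.combine-remQuot {N} N (a t))

    a-cyc : ∀ t → a (toℕ (cyc (len-1 c) t)) ≡ a t
    a-cyc t = cong (arc c) (cyc-toℕ-cyc (len-1 c) t)

    a-L : a L ≡ a 0
    a-L = cong (arc c) (Finₚ.toℕ-injective (trans (toℕ-cyc (len-1 c) L)
            (trans (n%n≡0 L) (sym (toℕ-cyc (len-1 c) 0)))))

    a-suc : ∀ t → tgt G (a t) ≡ src G (a (suc t))
    a-suc t = trans (closed c (cyc (len-1 c) t)) (cong (src G ∘′ arc c) (cyc-suc-toℕ-cyc (len-1 c) t))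

    a-distinct : ∀ s t → src G (a s) ≡ src G (a t) → cyc (len-1 c) s ≡ cyc (len-1 c) t
    a-distinct s t = distinct c (cyc (len-1 c) s) (cyc (len-1 c) t)

    slot-on-cycle : ∀ t → pos t ≤ deg-1 (owner t)
    slot-on-cycle t with pos t ≤? deg-1 (owner t)
    ... | yes on = on
    ... | no junk = contradiction (trans (sym (a-suc t)) (slotEnds-junk (owner t) (slot t) junk))
                                  (slotEnds-src≢1 (owner (suc t)) (slot (suc t)))

    a-ends : ∀ t → (src G (a t) , tgt G (a t)) ≡
                   (edgeVertex (owner t) (nbr (owner t) (pos t)) , edgeVertex (owner t) (nbr (owner t) (suc (pos t))))
    a-ends t = slotEnds-cycle (owner t) (slot t) (slot-on-cycle t)

    link : ∀ t → SamePair (owner t) (nbr (owner t) (suc (pos t))) (owner (suc t)) (nbr (owner (suc t)) (pos (suc t)))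
    link t = edgeVertex-injective _ _ _ _
      (trans (sym (cong proj₂ (a-ends t))) (trans (a-suc t) (cong proj₁ (a-ends (suc t)))))

    moving-tgt : ∀ t → owner t ≢ owner (suc t) → tgt G (a t) ≡ edgeVertex (owner t) (owner (suc t))
    moving-tgt t moves with link t
    ... | inj₁ (same , _) = contradiction same moves
    ... | inj₂ (_ , nbr≡next) = trans (cong proj₂ (a-ends t)) (cong (edgeVertex (owner t)) nbr≡next)

    ownerTrail : ∃[ t ] t < L × owner t ≢ owner (suc t) → ClosedTrail T L owner
    ownerTrail moves = record
      { closes = cong (λ e → proj₁ (remQuot {N} N e)) a-L
      ; step = λ {t} _ → step t
      ; moves = moves
      ; edges-distinct = λ {s} {t} s<L t<L s-moves t-moves same → cyc-suc-injective s<L t<L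
          (a-distinct (suc s) (suc t) (begin
            src G (a (suc s))                         ≡⟨ a-suc s ⟨
            tgt G (a s)                               ≡⟨ moving-tgt s s-moves ⟩
            edgeVertex (owner s) (owner (suc s))      ≡⟨ cong (Fin.suc ∘′ Fin.suc) (SamePair⇒pair≡ same) ⟩
            edgeVertex (owner t) (owner (suc t))      ≡⟨ moving-tgt t t-moves ⟨
            tgt G (a t)                               ≡⟨ a-suc t ⟩
            src G (a (suc t))                         ∎))
      }
      where
      open ≡-Reasoning
      step : ∀ t → owner t ≡ owner (suc t) ⊎ Edge T (owner t) (owner (suc t))
      step t with link t
      ... | inj₁ (same , _) = inj₁ same
      ... | inj₂ (_ , nbr≡next) = inj₂ (subst (Edge T (owner t)) nbr≡next (nbr-edge (owner t) (suc (pos t))))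

    module ConstantOwner (constant : ∀ {t} → t < L → owner t ≡ owner (suc t)) where
      x : Fin N
      x = owner 0

      D : ℕ
      D = suc (deg-1 x)

      k₀ : ℕ
      k₀ = pos 0

      owner≡x : ∀ {t} → t ≤ L → owner t ≡ x
      owner≡x {zero} _ = refl
      owner≡x {suc t} t<L = trans (sym (constant t<L)) (owner≡x (<⇒≤ t<L))

      pos<D : ∀ {t} → t ≤ L → pos t < D
      pos<D {t} t≤L = s≤s (subst (λ y → pos t ≤ deg-1 y) (owner≡x t≤L) (slot-on-cycle t))

      nbr-step : ∀ {y z} i j → y ≡ x → z ≡ x → SamePair y (nbr y i) z (nbr z j) →
                 cyc (deg-1 x) i ≡ cyc (deg-1 x) j
      nbr-step i j refl refl same = nbr-injective x {i} {j} (pair-injectiveʳ x (SamePair⇒pair≡ same))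

      pos-suc : ∀ {t} → t < L → pos (suc t) ≡ suc (pos t) % D
      pos-suc {t} t<L = begin
        pos (suc t)                           ≡⟨ m<n⇒m%n≡m (pos<D t<L) ⟨
        pos (suc t) % D                       ≡⟨ toℕ-cyc (deg-1 x) (pos (suc t)) ⟨
        toℕ (cyc (deg-1 x) (pos (suc t)))     ≡⟨ cong toℕ owner-step ⟨
        toℕ (cyc (deg-1 x) (suc (pos t)))     ≡⟨ toℕ-cyc (deg-1 x) (suc (pos t)) ⟩
        suc (pos t) % D                       ∎
        where
        open ≡-Reasoning
        owner-step = nbr-step (suc (pos t)) (pos (suc t)) (owner≡x (<⇒≤ t<L)) (owner≡x t<L) (link t)

      pos≡ : ∀ {t} → t ≤ L → pos t ≡ (k₀ + t) % D
      pos≡ {zero} _ = sym (trans (cong (_% D) (+-identityʳ k₀)) (m<n⇒m%n≡m (pos<D z≤n)))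
      pos≡ {suc t} t<L = begin
        pos (suc t)              ≡⟨ pos-suc t<L ⟩
        suc (pos t) % D          ≡⟨ cong (λ z → suc z % D) (pos≡ (<⇒≤ t<L)) ⟩
        (1 + (k₀ + t) % D) % D   ≡⟨ [m+n%d]%d≡[m+n]%d 1 (k₀ + t) D ⟩
        suc (k₀ + t) % D         ≡⟨ cong (_% D) (+-suc k₀ t) ⟨
        (k₀ + suc t) % D         ∎
        where open ≡-Reasoning

      a-D≡a-0 : D ≤ L → a D ≡ a 0
      a-D≡a-0 D≤L = begin
        a D                         ≡⟨ a≡combine D ⟩
        combine (owner D) (slot D)  ≡⟨ cong₂ combine (owner≡x D≤L) (Finₚ.toℕ-injective pos-D≡k₀) ⟩
        combine x (slot 0)          ≡⟨ a≡combine 0 ⟨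
        a 0                         ∎
        where
        open ≡-Reasoning
        pos-D≡k₀ : pos D ≡ k₀
        pos-D≡k₀ = begin
          pos D           ≡⟨ pos≡ D≤L ⟩
          (k₀ + D) % D    ≡⟨ [m+n]%n≡m%n k₀ D ⟩
          k₀ % D          ≡⟨ m<n⇒m%n≡m (pos<D z≤n) ⟩
          k₀              ∎

      D≤L : D ≤ L
      D≤L = ≮⇒≥ λ L<D → [m+n]%d≢m k₀ L D (pos<D z≤n) (s≤s z≤n) L<D
        (trans (sym (pos≡ ≤-refl)) (cong (λ e → toℕ (proj₂ (remQuot {N} N e))) a-L))

      L≤D : L ≤ D
      L≤D = ≮⇒≥ λ D<L → 1+n≢0 (begin
        D                       ≡⟨ m<n⇒m%n≡m D<L ⟨
        D % L                   ≡⟨ toℕ-cyc (len-1 c) D ⟨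
        toℕ (cyc (len-1 c) D)   ≡⟨ cong toℕ (a-distinct D 0 (cong (src G) (a-D≡a-0 (<⇒≤ D<L)))) ⟩
        toℕ (cyc (len-1 c) 0)   ≡⟨ toℕ-cyc (len-1 c) 0 ⟩
        0 % L                   ∎)
        where open ≡-Reasoning

      len-1≡ : deg-1 x ≡ len-1 c
      len-1≡ = suc-injective (≤-antisym D≤L L≤D)

      rotation : ∀ t → a t ≡ arcAt (vertexCycle x) (t + k₀)
      rotation t = begin
        a t                                   ≡⟨ a-cyc t ⟨
        a t′                                  ≡⟨ a≡combine t′ ⟩
        combine (owner t′) (slot t′)          ≡⟨ cong₂ combine (owner≡x t′≤L) (Finₚ.toℕ-injective slot≡) ⟩
        arcAt (vertexCycle x) (t + k₀)        ∎
        where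
        open ≡-Reasoning
        t′ = toℕ (cyc (len-1 c) t)
        t′≤L : t′ ≤ L
        t′≤L = <⇒≤ (Finₚ.toℕ<n (cyc (len-1 c) t))
        slot≡ : pos t′ ≡ toℕ (inject≤ (cyc (deg-1 x) (t + k₀)) (deg-1<n x))
        slot≡ = begin
          pos t′                            ≡⟨ pos≡ t′≤L ⟩
          (k₀ + t′) % D                     ≡⟨ cong (λ l → (k₀ + toℕ (cyc l t)) % D) len-1≡ ⟨
          (k₀ + toℕ (cyc (deg-1 x) t)) % D  ≡⟨ cong (λ z → (k₀ + z) % D) (toℕ-cyc (deg-1 x) t) ⟩
          (k₀ + t % D) % D                  ≡⟨ [m+n%d]%d≡[m+n]%d k₀ t D ⟩
          (k₀ + t) % D                      ≡⟨ cong (_% D) (+-comm k₀ t) ⟩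
          (t + k₀) % D                      ≡⟨ toℕ-cyc (deg-1 x) (t + k₀) ⟨
          toℕ (cyc (deg-1 x) (t + k₀))      ≡⟨ Finₚ.toℕ-inject≤ _ (deg-1<n x) ⟨
          toℕ (inject≤ (cyc (deg-1 x) (t + k₀)) (deg-1<n x)) ∎

      sameCycle : SameCycle (vertexCycle x) c
      sameCycle = len-1≡ , k₀ , rotation

    ownerCycle : Acyclic T → ∃[ x ] SameCycle (vertexCycle x) c
    ownerCycle acyclic with anyUpTo? (λ t → ¬? (owner t Fin.≟ owner (suc t))) L
    ... | yes moves = contradiction (ownerTrail moves) (acyclic⇒¬ClosedTrail acyclic L owner)
    ... | no none = ConstantOwner.x constant , ConstantOwner.sameCycle constant
      where
      constant : ∀ {t} → t < L → owner t ≡ owner (suc t)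
      constant {t} t<L = decidable-stable (owner t Fin.≟ owner (suc t)) (λ moves → none (t , t<L , moves))

  vertexCycle-realizes : Acyclic T → IsoToφ T G
  vertexCycle-realizes acyclic = record
    { f = vertexCycle
    ; injective = vertexCycle-injective
    ; surjective = λ c → Owners.ownerCycle c acyclic
    ; adjacency = vertexCycle-adjacency
    }

walk⇒neighbour : ∀ {n} (T : SimpleGraph n) {x y} → x ≢ y → Walk T x y → ∃[ z ] Edge T x z
walk⇒neighbour T x≢y record { len = zero ; start = start ; end = end } = contradiction (trans (sym start) end) x≢y
walk⇒neighbour T x≢y record { len = suc _ ; vtx = vtx ; start = start ; step = step } =
  vtx 1 , subst (λ v → Edge T v (vtx 1)) start (step 0 (s≤s z≤n))

another : ∀ {n} → Fin (suc (suc n)) → Fin (suc (suc n))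
another Fin.zero = Fin.suc Fin.zero
another (Fin.suc _) = Fin.zero

another≢ : ∀ {n} (x : Fin (suc (suc n))) → x ≢ another x
another≢ Fin.zero ()
another≢ (Fin.suc _) ()

connected⇒neighbour : ∀ {n} (T : SimpleGraph (suc (suc n))) → Connected T → ∀ x → ∃[ y ] Edge T x y
connected⇒neighbour T connected x = walk⇒neighbour T (another≢ x) (connected x (another x))

Fin1-unique : (a b : Fin 1) → a ≡ b
Fin1-unique Fin.zero Fin.zero = refl

loopGraph : Multigraph
loopGraph = record { V = 1 ; E = 1 ; src = λ _ → Fin.zero ; tgt = λ _ → Fin.zero }

loop : SimpleCycle loopGraph
loop = record { len-1 = 0 ; arc = λ _ → Fin.zero ; closed = λ _ → refl ; distinct = λ s t _ → Fin1-unique s t }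

loop-unique : ∀ c → SameCycle loop c
loop-unique c = length-one (len-1 c) (λ s t → distinct c s t refl) , 0 , λ _ → Fin1-unique _ _
  where
  length-one : ∀ l → (∀ (s t : Fin (suc l)) → s ≡ t) → 0 ≡ l
  length-one zero _ = refl
  length-one (suc l) all-equal with all-equal Fin.zero (Fin.suc Fin.zero)
  ... | ()

loop-realizes : (T : SimpleGraph 1) → IsoToφ T loopGraph
loop-realizes T = record
  { f = λ _ → loop
  ; injective = λ i j _ → Fin1-unique i j
  ; surjective = λ c → Fin.zero , loop-unique c
  ; adjacency = λ i j → mk⇔ (λ e → contradiction (Fin1-unique i j) (Edge⇒≢ T e))
                            (λ (different , _) → contradiction (loop-unique loop) different)
  }

corollary2 : ∀ (n : ℕ) (T : SimpleGraph n) → IsTree T → Realizable T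
corollary2 zero T (() , _)
corollary2 (suc zero) T _ = loopGraph , loop-realizes T
corollary2 (suc (suc m)) T (_ , connected , acyclic) = G , vertexCycle-realizes acyclic
  where open CycleGraph T (connected⇒neighbour T connected)
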